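{- For all integers $n\ge2$, \[T_{n+1}T_n=\sum_{l=2}^n(T_l+T_{l-2})T_{n-l+2}^2.\]
   Context: Tribonacci numbers: $T_n=T_{n-1}+T_{n-2}+T_{n-3}+\delta_{n,2}$ for all integers $n$, with $T_n=0$ for $n<2$; $\delta_{i,j}$ is $1$ if $i=j$ and $0$ otherwise. -}

module Defs where

open import Data.Nat using (ℕ; zero; suc; _+_; _*_; _∸_; _<ᵇ_)
open import Data.Bool using (if_then_else_)

-- Negative indices are
-- never needed in the statement (all indices occurring are ≥ 0).
T : ℕ → ℕ
T zero = 0
T (suc zero) = 0
T (suc (suc zero)) = 1
T (suc (suc (suc n))) = T (suc (suc n)) + T (suc n) + T n

sumFromTo : ℕ → ℕ → (ℕ → ℕ) → ℕ
sumFromTo a zero f = if 0 <ᵇ a then 0 else f 0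
sumFromTo a (suc b) f = sumFromTo a b f + (if suc b <ᵇ a then 0 else f (suc b))

{-# OPTIONS --safe #-}
-- Put w l = T l + T (l ∸ 2) and S n = Σ_{l ≤ n} w (2 + l) T (n ∸ l)²; re-indexed by
-- l ↦ 2 + l, the sum of the theorem is S n (the two terms this adds vanish as T 0 = T 1 = 0).
-- Peeling off leading terms gives S (1 + n) = T (1 + n)² + Σ_{l ≤ n} w (3 + l) T (n ∸ l)²
-- and so on, and w obeys the Tribonacci recurrence from index 5 on; hence S satisfies
-- S (3 + n) = S (2 + n) + S (1 + n) + S n + T (1 + n)² + T (3 + n)².
-- The products T (1 + n) T n satisfy the same recurrence and agree with S for n ≤ 2.
module Submission where

open import Defs
open import Data.Bool using (true; false; if_then_else_)
open import Data.Bool.Base using () renaming (T to IsTrue)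
open import Data.Nat using (ℕ; zero; suc; _+_; _*_; _∸_; _≤_; _<_; _<ᵇ_; z≤n; s≤s)
open import Data.Nat.Properties
  using (+-comm; +-assoc; +-identityʳ; +-suc; *-zeroʳ; *-distribʳ-+; m≤n+m; <ᵇ⇒<;
         ∸-monoʳ-≤; m+n∸n≡m; ≤-trans; ≤-reflexive)
open import Data.Nat.Tactic.RingSolver using (solve-∀)
open import Relation.Binary.PropositionalEquality
  using (_≡_; refl; sym; trans; cong; cong₂; subst; module ≡-Reasoning)
open ≡-Reasoning

sumUpTo : ℕ → (ℕ → ℕ) → ℕ
sumUpTo zero f = f 0
sumUpTo (suc n) f = sumUpTo n f + f (suc n)

sumUpTo-cong : ∀ n {f g : ℕ → ℕ} → (∀ l → f l ≡ g l) → sumUpTo n f ≡ sumUpTo n g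
sumUpTo-cong zero f≗g = f≗g 0
sumUpTo-cong (suc n) f≗g = cong₂ _+_ (sumUpTo-cong n f≗g) (f≗g (suc n))

sumUpTo-suc-head : ∀ n (f : ℕ → ℕ) → sumUpTo (suc n) f ≡ f 0 + sumUpTo n (λ l → f (suc l))
sumUpTo-suc-head zero f = refl
sumUpTo-suc-head (suc n) f =
  trans (cong (_+ f (2 + n)) (sumUpTo-suc-head n f)) (+-assoc (f 0) _ _)

sumUpTo-+ : ∀ n (f g : ℕ → ℕ) → sumUpTo n (λ l → f l + g l) ≡ sumUpTo n f + sumUpTo n g
sumUpTo-+ zero f g = refl
sumUpTo-+ (suc n) f g = begin
  sumUpTo n (λ l → f l + g l) + (f (suc n) + g (suc n))
    ≡⟨ cong (_+ (f (suc n) + g (suc n))) (sumUpTo-+ n f g) ⟩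
  sumUpTo n f + sumUpTo n g + (f (suc n) + g (suc n))
    ≡⟨ +-interchange (sumUpTo n f) (sumUpTo n g) (f (suc n)) (g (suc n)) ⟩
  sumUpTo n f + f (suc n) + (sumUpTo n g + g (suc n)) ∎
  where
  +-interchange : ∀ a b c d → a + b + (c + d) ≡ a + c + (b + d)
  +-interchange = solve-∀

sumUpTo-vanishing-tail : ∀ n (f : ℕ → ℕ) → (∀ l → n < l → f l ≡ 0) →
                         ∀ k → sumUpTo (k + n) f ≡ sumUpTo n f
sumUpTo-vanishing-tail n f vanish zero = refl
sumUpTo-vanishing-tail n f vanish (suc k) = begin
  sumUpTo (k + n) f + f (suc (k + n)) ≡⟨ cong (sumUpTo (k + n) f +_) (vanish _ (s≤s (m≤n+m n k))) ⟩
  sumUpTo (k + n) f + 0               ≡⟨ +-identityʳ _ ⟩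
  sumUpTo (k + n) f                   ≡⟨ sumUpTo-vanishing-tail n f vanish k ⟩
  sumUpTo n f                         ∎

if-<ᵇ-vanishing : ∀ a (f : ℕ → ℕ) → (∀ l → l < a → f l ≡ 0) →
                  ∀ l → (if l <ᵇ a then 0 else f l) ≡ f l
if-<ᵇ-vanishing a f vanish l with l <ᵇ a in l<ᵇa
... | true = sym (vanish l (<ᵇ⇒< l a (subst IsTrue (sym l<ᵇa) _)))
... | false = refl

sumFromTo≡sumUpTo : ∀ a (f : ℕ → ℕ) → (∀ l → l < a → f l ≡ 0) →
                    ∀ n → sumFromTo a n f ≡ sumUpTo n f
sumFromTo≡sumUpTo a f vanish zero = if-<ᵇ-vanishing a f vanish 0
sumFromTo≡sumUpTo a f vanish (suc n) =
  cong₂ _+_ (sumFromTo≡sumUpTo a f vanish n) (if-<ᵇ-vanishing a f vanish (suc n))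

convolution : (ℕ → ℕ) → (ℕ → ℕ) → ℕ → ℕ
convolution f g n = sumUpTo n (λ l → f l * g (n ∸ l))

convolution-suc : ∀ (f g : ℕ → ℕ) n →
                  convolution f g (suc n) ≡ f 0 * g (suc n) + convolution (λ l → f (suc l)) g n
convolution-suc f g n = sumUpTo-suc-head n (λ l → f l * g (suc n ∸ l))

convolution-congˡ : ∀ {f h : ℕ → ℕ} (g : ℕ → ℕ) n → (∀ l → f l ≡ h l) →
                    convolution f g n ≡ convolution h g n
convolution-congˡ g n f≗h = sumUpTo-cong n (λ l → cong (_* g (n ∸ l)) (f≗h l))

convolution-+ˡ : ∀ (f h g : ℕ → ℕ) n →
                 convolution (λ l → f l + h l) g n ≡ convolution f g n + convolution h g n
convolution-+ˡ f h g n =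
  trans (sumUpTo-cong n (λ l → *-distribʳ-+ (g (n ∸ l)) (f l) (h l)))
        (sumUpTo-+ n (λ l → f l * g (n ∸ l)) (λ l → h l * g (n ∸ l)))

TribonacciRecurrence : (ℕ → ℕ) → (ℕ → ℕ) → Set
TribonacciRecurrence e u = ∀ n → u (3 + n) ≡ u (2 + n) + u (1 + n) + u n + e n

tribonacciRecurrence-unique : ∀ {e u v : ℕ → ℕ} →
  TribonacciRecurrence e u → TribonacciRecurrence e v →
  u 0 ≡ v 0 → u 1 ≡ v 1 → u 2 ≡ v 2 → ∀ n → u n ≡ v n
tribonacciRecurrence-unique {e} {u} {v} rec-u rec-v u₀ u₁ u₂ = go
  where
  go : ∀ n → u n ≡ v n
  go 0 = u₀
  go 1 = u₁
  go 2 = u₂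
  go (suc (suc (suc n))) = begin
    u (3 + n)                             ≡⟨ rec-u n ⟩
    u (2 + n) + u (1 + n) + u n + e n     ≡⟨ cong (_+ e n) (cong₂ _+_ (cong₂ _+_ (go (suc (suc n))) (go (suc n))) (go n)) ⟩
    v (2 + n) + v (1 + n) + v n + e n     ≡⟨ sym (rec-v n) ⟩
    v (3 + n)                             ∎

T-≤1 : ∀ {m} → m ≤ 1 → T m ≡ 0
T-≤1 z≤n = refl
T-≤1 (s≤s z≤n) = refl

Tsq : ℕ → ℕ
Tsq n = T n * T n

weight : ℕ → ℕ
weight l = T l + T (l ∸ 2)

weight-rec : ∀ l → weight (5 + l) ≡ weight (4 + l) + weight (3 + l) + weight (2 + l)
weight-rec l = begin
  (T (4 + l) + T (3 + l) + T (2 + l)) + (T (2 + l) + T (1 + l) + T l)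
    ≡⟨ +-interchange₃ (T (4 + l)) (T (3 + l)) (T (2 + l)) (T (2 + l)) (T (1 + l)) (T l) ⟩
  (T (4 + l) + T (2 + l)) + (T (3 + l) + T (1 + l)) + (T (2 + l) + T l) ∎
  where
  +-interchange₃ : ∀ a b c x y z → (a + b + c) + (x + y + z) ≡ (a + x) + (b + y) + (c + z)
  +-interchange₃ = solve-∀

weightedSquares : ℕ → ℕ → ℕ
weightedSquares k = convolution (λ l → weight (k + l)) Tsq

weightedSquares-suc : ∀ k n →
  weightedSquares k (suc n) ≡ weight k * Tsq (suc n) + weightedSquares (suc k) n
weightedSquares-suc k n =
  trans (convolution-suc (λ l → weight (k + l)) Tsq n)
        (cong₂ _+_ (cong (λ m → weight m * Tsq (suc n)) (+-identityʳ k))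
                   (convolution-congˡ Tsq n (λ l → cong weight (+-suc k l))))

weightedSquares-rec : ∀ n →
  weightedSquares 5 n ≡ weightedSquares 4 n + weightedSquares 3 n + weightedSquares 2 n
weightedSquares-rec n = begin
  weightedSquares 5 n
    ≡⟨ convolution-congˡ Tsq n weight-rec ⟩
  convolution (λ l → weight (4 + l) + weight (3 + l) + weight (2 + l)) Tsq n
    ≡⟨ convolution-+ˡ (λ l → weight (4 + l) + weight (3 + l)) (λ l → weight (2 + l)) Tsq n ⟩
  convolution (λ l → weight (4 + l) + weight (3 + l)) Tsq n + weightedSquares 2 n
    ≡⟨ cong (_+ weightedSquares 2 n) (convolution-+ˡ (λ l → weight (4 + l)) (λ l → weight (3 + l)) Tsq n) ⟩
  weightedSquares 4 n + weightedSquares 3 n + weightedSquares 2 n ∎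

weightedSquares-tribonacci :
  TribonacciRecurrence (λ n → Tsq (1 + n) + Tsq (3 + n)) (weightedSquares 2)
weightedSquares-tribonacci n = begin
  weightedSquares 2 (3 + n)                      ≡⟨ unfold₃ ⟩
  1 * s₃ + (1 * s₂ + (3 * s₁ + weightedSquares 5 n)) ≡⟨ cong (λ x → 1 * s₃ + (1 * s₂ + (3 * s₁ + x))) (weightedSquares-rec n) ⟩
  1 * s₃ + (1 * s₂ + (3 * s₁ + (C + B + A)))     ≡⟨ regroup s₁ s₂ s₃ A B C ⟩
  (1 * s₂ + (1 * s₁ + C)) + (1 * s₁ + B) + A + (s₁ + s₃)
    ≡⟨ cong (λ x → x + A + (s₁ + s₃)) (sym (cong₂ _+_ unfold₂ unfold₁)) ⟩
  weightedSquares 2 (2 + n) + weightedSquares 2 (1 + n) + weightedSquares 2 n + (s₁ + s₃) ∎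
  where
  s₁ = Tsq (1 + n)
  s₂ = Tsq (2 + n)
  s₃ = Tsq (3 + n)
  A = weightedSquares 2 n
  B = weightedSquares 3 n
  C = weightedSquares 4 n
  unfold₁ : weightedSquares 2 (1 + n) ≡ 1 * s₁ + B
  unfold₁ = weightedSquares-suc 2 n
  unfold₂ : weightedSquares 2 (2 + n) ≡ 1 * s₂ + (1 * s₁ + C)
  unfold₂ = trans (weightedSquares-suc 2 (1 + n)) (cong (1 * s₂ +_) (weightedSquares-suc 3 n))
  unfold₃ : weightedSquares 2 (3 + n) ≡ 1 * s₃ + (1 * s₂ + (3 * s₁ + weightedSquares 5 n))
  unfold₃ = trans (weightedSquares-suc 2 (2 + n)) (cong (1 * s₃ +_)
              (trans (weightedSquares-suc 3 (1 + n)) (cong (1 * s₂ +_) (weightedSquares-suc 4 n))))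
  regroup : ∀ s₁ s₂ s₃ A B C → 1 * s₃ + (1 * s₂ + (3 * s₁ + (C + B + A)))
                             ≡ (1 * s₂ + (1 * s₁ + C)) + (1 * s₁ + B) + A + (s₁ + s₃)
  regroup = solve-∀

products-tribonacci :
  TribonacciRecurrence (λ n → Tsq (1 + n) + Tsq (3 + n)) (λ n → T (1 + n) * T n)
products-tribonacci n = identity (T n) (T (1 + n)) (T (2 + n))
  where
  identity : ∀ x y z → ((z + y + x) + z + y) * (z + y + x)
                     ≡ (z + y + x) * z + z * y + y * x + (y * y + (z + y + x) * (z + y + x))
  identity = solve-∀

weightedSquares-closedForm : ∀ n → weightedSquares 2 n ≡ T (1 + n) * T n
weightedSquares-closedForm =
  tribonacciRecurrence-unique weightedSquares-tribonacci products-tribonacci refl refl refl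

mainTheorem15 : (n : ℕ) → 2 ≤ n →
    T (n + 1) * T n ≡ sumFromTo 2 n (λ l → (T l + T (l ∸ 2)) * (T (n + 2 ∸ l) * T (n + 2 ∸ l)))
mainTheorem15 n _ = sym (begin
  sumFromTo 2 n F                 ≡⟨ sumFromTo≡sumUpTo 2 F head-vanishes n ⟩
  sumUpTo n F                     ≡⟨ sumUpTo-cong n (λ l → cong (λ m → weight l * Tsq (m ∸ l)) (+-comm n 2)) ⟩
  sumUpTo n G                     ≡⟨ sym (sumUpTo-vanishing-tail n G tail-vanishes 2) ⟩
  convolution weight Tsq (2 + n)  ≡⟨ trans (weightedSquares-suc 0 (1 + n)) (weightedSquares-suc 1 n) ⟩
  weightedSquares 2 n             ≡⟨ weightedSquares-closedForm n ⟩
  T (1 + n) * T n                 ≡⟨ cong (λ m → T m * T n) (+-comm 1 n) ⟩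
  T (n + 1) * T n                 ∎)
  where
  F G : ℕ → ℕ
  F l = weight l * Tsq (n + 2 ∸ l)
  G l = weight l * Tsq (2 + n ∸ l)
  head-vanishes : ∀ l → l < 2 → F l ≡ 0
  head-vanishes 0 _ = refl
  head-vanishes 1 _ = refl
  head-vanishes (suc (suc l)) (s≤s (s≤s ()))
  tail-vanishes : ∀ l → n < l → G l ≡ 0
  tail-vanishes (suc l) (s≤s n≤l) = begin
    weight (suc l) * Tsq (suc n ∸ l) ≡⟨ cong (λ t → weight (suc l) * (t * t)) (T-≤1 suc-n∸l≤1) ⟩
    weight (suc l) * 0               ≡⟨ *-zeroʳ (weight (suc l)) ⟩
    0                                ∎
    where
    suc-n∸l≤1 : suc n ∸ l ≤ 1
    suc-n∸l≤1 = ≤-trans (∸-monoʳ-≤ (suc n) n≤l) (≤-reflexive (m+n∸n≡m 1 n))
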